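{- Let $w\in S_n$ and suppose the first descent of $w$, at position $i$ (entries $(i,w_i)$ and $(i+1,w_{i+1})$), is a heavy reduction pair. Let $j$ be minimal with $w_j>w_{i+1}$ and let $v(w)\in S_{n-1}$ be the permutation order-isomorphic to $w_1\cdots w_{j-1}\,w_{j+1}\cdots w_i\,w_j\,w_{i+2}\cdots w_n$. Then the diagrams $O_w-(i+1,w_i)$ and $O_{v(w)}$ are identical up to permutations of rows and columns.
   Context: For $u\in S_m$, $O_u=\{(a,u_b):1\le a<b\le m,\ u_b>u_a\}\subseteq[m]\times[m]$. For $D\subseteq[n]\times[n]$ and a cell $(a,b)$, $D-(a,b)\subseteq[n-1]\times[n-1]$ is obtained by deleting row $a$ and column $b$ and reindexing. The descent at $i$ ($w_i>w_{i+1}$) is a heavy reduction pair if: (1) no $k>i+1$ has $w_k<w_{i+1}$; (2) no $k<i$ has $w_k>w_i$; (3) there is an integer $m$ with $w_{i+1}\le m\le w_i$ such that no $k<i$ has $w_{i+1}<w_k\le m$ and no $k>i+1$ has $m<w_k<w_i$. -}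

module Defs where

open import Data.Nat using (ℕ; zero; suc; _≤_; _<_)
open import Data.Nat.Properties using (_≟_; _<?_)
open import Data.Fin using (Fin; toℕ; inject₁; punchIn)
  renaming (suc to fsuc)
open import Data.Fin.Permutation using (Permutation′; _⟨$⟩ʳ_)
open import Data.Product using (Σ; ∃; _×_; _,_)
open import Relation.Nullary using (¬_; yes; no)
open import Relation.Binary.PropositionalEquality using (_≡_)
open import Function.Bundles using (_⇔_)

-- A permutation in S_n, in one-line notation w_0 … w_{n-1}
-- (0-based positions and values; all conditions below only compare
-- positions/values, so the shift from 1-based indexing is harmless).
Perm : ℕ → Set
Perm n = Permutation′ n

val : ∀ {n} → Perm n → Fin n → ℕ
val w k = toℕ (w ⟨$⟩ʳ k)

-- A diagram in [n] × [n] (row, column), as a predicate.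
Diagram : ℕ → Set₁
Diagram n = Fin n → Fin n → Set

O : ∀ {m} → Perm m → Diagram m
O u r c = Σ _ λ b → (toℕ r < toℕ b) × (u ⟨$⟩ʳ b ≡ c) × (val u r < val u b)

delete : ∀ {k} → Diagram (suc k) → Fin (suc k) → Fin (suc k) → Diagram k
delete D a b r c = D (punchIn a r) (punchIn b c)

EquivUpToRowsCols : ∀ {k} → Diagram k → Diagram k → Set
EquivUpToRowsCols {k} D₁ D₂ =
  Σ (Permutation′ k) λ σ → Σ (Permutation′ k) λ τ →
    ∀ r c → D₁ r c ⇔ D₂ (σ ⟨$⟩ʳ r) (τ ⟨$⟩ʳ c)

IsDescent : ∀ {n} → Perm (suc n) → Fin n → Set
IsDescent w i = val w (fsuc i) < val w (inject₁ i)

IsFirstDescent : ∀ {n} → Perm (suc n) → Fin n → Set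
IsFirstDescent w i = IsDescent w i × (∀ k → toℕ k < toℕ i → ¬ IsDescent w k)

IsHeavyReductionPair : ∀ {n} → Perm (suc n) → Fin n → Set
IsHeavyReductionPair w i =
  IsDescent w i
  × (∀ k → suc (toℕ i) < toℕ k → ¬ (val w k < val w (fsuc i)))
  × (∀ k → toℕ k < toℕ i → ¬ (val w (inject₁ i) < val w k))
  × ∃ λ m → (val w (fsuc i) ≤ m) × (m ≤ val w (inject₁ i))
      × (∀ k → toℕ k < toℕ i → ¬ ((val w (fsuc i) < val w k) × (val w k ≤ m)))
      × (∀ k → suc (toℕ i) < toℕ k → ¬ ((m < val w k) × (val w k < val w (inject₁ i))))

IsMinAbove : ∀ {n} → Perm (suc n) → Fin n → Fin (suc n) → Set
IsMinAbove w i j = (val w (fsuc i) < val w j)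
  × (∀ k → toℕ k < toℕ j → ¬ (val w (fsuc i) < val w k))

-- The word w_1 … w_{j-1} w_{j+1} … w_i w_j w_{i+2} … w_n (length n),
-- written 0-based: position p holds w_j if p = i, w_p if p < j,
-- and w_{p+1} otherwise.
vWord : ∀ {n} → Perm (suc n) → Fin n → Fin (suc n) → Fin n → ℕ
vWord w i j p with toℕ p ≟ toℕ i
... | yes _ = val w j
... | no _ with toℕ p <? toℕ j
...   | yes _ = val w (inject₁ p)
...   | no _ = val w (fsuc p)

OrderIsomorphic : ∀ {n} → Perm n → (Fin n → ℕ) → Set
OrderIsomorphic v x = ∀ p q → (val v p < val v q) ⇔ (x p < x q)

-- Rows of the deleted diagram are matched with the rows of O_v in order, and the column
-- holding w_b (b ≠ i) with the column of v holding the same letter of the word, which is w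
-- with w_{i+1} deleted and w_j moved to position i.  Every cell then compares the same two
-- letters on both sides, except where the move intervenes.  Since i is the first descent, w
-- increases up to position i, so among the first i letters nothing changes.  In the column
-- of w_{i+1} (of w_j for v) both diagrams have a cell in row r exactly when r < j, by
-- minimality of j.  Finally condition (3) puts every entry after position i+1 either above
-- w_i or below w_j, so it compares alike with each of w_j, …, w_i, the only letters moved.

module Submission where

open import Defs
open import Data.Nat
  using (ℕ; suc; _≤_; _<_; _≤′_; ≤′-refl; ≤′-step; z≤n; s≤s; s<s; s<s⁻¹)
open import Data.Nat.Properties
open import Data.Fin using (Fin; toℕ; fromℕ<; inject₁; punchIn)
  renaming (zero to fzero; suc to fsuc)
open import Data.Fin.Properties using (toℕ-injective; toℕ-fromℕ<; toℕ-inject₁; toℕ<n)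
open import Data.Fin.Permutation
  using (Permutation′; _⟨$⟩ʳ_; _⟨$⟩ˡ_; inverseʳ; remove; flip; _∘ₚ_; punchIn-permute)
  renaming (id to idₚ)
open import Data.Product using (_×_; _,_; proj₁; proj₂)
open import Data.Product.Function.NonDependent.Propositional using (_×-⇔_)
open import Data.Sum using (_⊎_; inj₁; inj₂)
open import Data.Empty using (⊥-elim)
open import Function using (_∘_)
open import Function.Bundles using (_⇔_; mk⇔; Equivalence; Injection)
open import Function.Properties.Inverse using (↔⇒↣)
import Function.Properties.Equivalence as ⇔
open import Function.Related.Propositional using (module EquationalReasoning)
open import Relation.Nullary using (¬_; yes; no; contradiction)
open import Relation.Binary using (tri<; tri≈; tri>)
open import Relation.Binary.PropositionalEquality

punchInℕ : ℕ → ℕ → ℕ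
punchInℕ x q with q <? x
... | yes _ = q
... | no _ = suc q

punchInℕ-< : ∀ {x q} → q < x → punchInℕ x q ≡ q
punchInℕ-< {x} {q} q<x with q <? x
... | yes _ = refl
... | no q≮x = contradiction q<x q≮x

punchInℕ-≥ : ∀ {x q} → x ≤ q → punchInℕ x q ≡ suc q
punchInℕ-≥ {x} {q} x≤q with q <? x
... | yes q<x = contradiction x≤q (<⇒≱ q<x)
... | no _ = refl

punchInℕ-≤ : ∀ x q → punchInℕ x q ≤ suc q
punchInℕ-≤ x q with q <? x
... | yes _ = n≤1+n q
... | no _ = ≤-refl

punchInℕ-mono-< : ∀ x {a b} → a < b → punchInℕ x a < punchInℕ x b
punchInℕ-mono-< x {a} {b} a<b with a <? x | b <? x
... | yes _ | yes _ = a<b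
... | yes _ | no _ = m<n⇒m<1+n a<b
... | no a≮x | yes b<x = contradiction (<-trans a<b b<x) a≮x
... | no _ | no _ = s≤s a<b

punchInℕ-suc : ∀ x q → punchInℕ (suc x) (suc q) ≡ suc (punchInℕ x q)
punchInℕ-suc x q with q <? x
... | yes q<x = punchInℕ-< (s≤s q<x)
... | no q≮x = punchInℕ-≥ (s≤s (≮⇒≥ q≮x))

toℕ-punchIn : ∀ {k} (x : Fin (suc k)) (q : Fin k) →
              toℕ (punchIn x q) ≡ punchInℕ (toℕ x) (toℕ q)
toℕ-punchIn fzero q = sym (punchInℕ-≥ {q = toℕ q} z≤n)
toℕ-punchIn (fsuc x) fzero = sym (punchInℕ-< {suc (toℕ x)} (s≤s z≤n))
toℕ-punchIn (fsuc x) (fsuc q) =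
  trans (cong suc (toℕ-punchIn x q)) (sym (punchInℕ-suc (toℕ x) (toℕ q)))

extend : ∀ {n} → (Fin n → ℕ) → ℕ → ℕ
extend {n} f k with k <? n
... | yes k<n = f (fromℕ< k<n)
... | no _ = 0

extend-toℕ : ∀ {n} (f : Fin n → ℕ) a → extend f (toℕ a) ≡ f a
extend-toℕ {n} f a with toℕ a <? n
... | yes a<n = cong f (toℕ-injective (toℕ-fromℕ< a<n))
... | no a≮n = contradiction (toℕ<n a) a≮n

extend-∀ : ∀ {n} {f : Fin n → ℕ} {P : ℕ → ℕ → Set} →
           (∀ a → P (toℕ a) (f a)) → ∀ {k} → k < n → P k (extend f k)
extend-∀ {n} {f} {P} H {k} k<n with k <? n
... | yes k<n′ =
  subst (λ t → P t (f (fromℕ< k<n′))) (toℕ-fromℕ< k<n′) (H (fromℕ< k<n′))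
... | no k≮n = contradiction k<n k≮n

extend-injective : ∀ {n} {f : Fin n → ℕ} → (∀ {a b} → f a ≡ f b → a ≡ b) →
                   ∀ {k l} → k < n → l < n → extend f k ≡ extend f l → k ≡ l
extend-injective {n} f-injective {k} {l} k<n l<n eq with k <? n | l <? n
... | yes k<n′ | yes l<n′ =
  trans (sym (toℕ-fromℕ< k<n′)) (trans (cong toℕ (f-injective eq)) (toℕ-fromℕ< l<n′))
... | no k≮n | _ = contradiction k<n k≮n
... | _ | no l≮n = contradiction l<n l≮n

ascending-≤ : ∀ {f : ℕ → ℕ} {c} → (∀ {k} → k < c → f k ≤ f (suc k)) →
              ∀ {a b} → a ≤ b → b ≤ c → f a ≤ f b
ascending-≤ {f} {c} step a≤b = go (≤⇒≤′ a≤b)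
  where
  go : ∀ {a b} → a ≤′ b → b ≤ c → f a ≤ f b
  go ≤′-refl _ = ≤-refl
  go (≤′-step a≤′b) b<c = ≤-trans (go a≤′b (<⇒≤ b<c)) (step b<c)

NonInversion : (ℕ → ℕ) → ℕ → ℕ → Set
NonInversion f a b = a < b × f a < f b

nonInversion⇔< : ∀ {f : ℕ → ℕ} {b} → (∀ {a} → a < b → f a < f b) →
                 ∀ {a} → NonInversion f a b ⇔ a < b
nonInversion⇔< increasing = mk⇔ proj₁ (λ a<b → a<b , increasing a<b)

module Reduction (n i j : ℕ) (W : ℕ → ℕ)
  (W-increasing : ∀ {a b} → a < b → b ≤ i → W a < W b)
  (j≤i : j ≤ i)
  (next<W-j : W (suc i) < W j)
  (W<next : ∀ {k} → k < j → W k < W (suc i))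
  (tail-outside : ∀ {k} → suc i < k → k ≤ n → W k < W j ⊎ W i < W k)
  where

  W-increasing-≤ : ∀ {a b} → a ≤ b → b ≤ i → W a ≤ W b
  W-increasing-≤ a≤b b≤i with m≤n⇒m<n∨m≡n a≤b
  ... | inj₁ a<b = <⇒≤ (W-increasing a<b b≤i)
  ... | inj₂ refl = ≤-refl

  -- The p-th letter of the word is the letter of W at position wordPos p.
  wordPos : ℕ → ℕ
  wordPos p with p ≟ i
  ... | yes _ = j
  ... | no _ = punchInℕ j p

  wordPos-i : wordPos i ≡ j
  wordPos-i with i ≟ i
  ... | yes _ = refl
  ... | no i≢i = contradiction refl i≢i

  wordPos-≢ : ∀ {p} → p ≢ i → wordPos p ≡ punchInℕ j p
  wordPos-≢ {p} p≢i with p ≟ i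
  ... | yes p≡i = contradiction p≡i p≢i
  ... | no _ = refl

  wordPos-< : ∀ {p} → p < j → wordPos p ≡ p
  wordPos-< p<j = trans (wordPos-≢ (<⇒≢ (<-≤-trans p<j j≤i))) (punchInℕ-< p<j)

  wordPos-> : ∀ {p} → i < p → wordPos p ≡ suc p
  wordPos-> i<p = trans (wordPos-≢ (>⇒≢ i<p)) (punchInℕ-≥ (≤-trans j≤i (<⇒≤ i<p)))

  wordPos-shift : ∀ {p} → j ≤ p → p < i → wordPos p ≡ suc p
  wordPos-shift j≤p p<i = trans (wordPos-≢ (<⇒≢ p<i)) (punchInℕ-≥ j≤p)

  wordPos-window : ∀ {p} → j ≤ p → p ≤ i → j ≤ wordPos p × wordPos p ≤ i
  wordPos-window j≤p p≤i with m≤n⇒m<n∨m≡n p≤i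
  ... | inj₂ refl rewrite wordPos-i = ≤-refl , j≤i
  ... | inj₁ p<i rewrite wordPos-shift j≤p p<i = m≤n⇒m≤1+n j≤p , p<i

  word-increasing : ∀ {a b} → a < b → b < i → W (wordPos a) < W (wordPos b)
  word-increasing {a} {b} a<b b<i
    rewrite wordPos-≢ (<⇒≢ (<-trans a<b b<i)) | wordPos-≢ (<⇒≢ b<i) =
    W-increasing (punchInℕ-mono-< j a<b) (≤-trans (punchInℕ-≤ j b) b<i)

  ¬window<tail : ∀ {a k} → j ≤ a → a ≤ i → W k < W j → ¬ W a < W k
  ¬window<tail j≤a a≤i Wk<Wj Wa<Wk = <⇒≱ (<-trans Wa<Wk Wk<Wj) (W-increasing-≤ j≤a a≤i)

  window<tail⇔ : ∀ {a k} → j ≤ a → a ≤ i → suc i < k → k ≤ n →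
                 W a < W k ⇔ W i < W k
  window<tail⇔ j≤a a≤i i+1<k k≤n with tail-outside i+1<k k≤n
  ... | inj₁ Wk<Wj =
        mk⇔ (⊥-elim ∘ ¬window<tail j≤a a≤i Wk<Wj)
            (⊥-elim ∘ ¬window<tail j≤i ≤-refl Wk<Wj)
  ... | inj₂ Wi<Wk =
        mk⇔ (λ _ → Wi<Wk) (λ _ → ≤-<-trans (W-increasing-≤ a≤i ≤-refl) Wi<Wk)

  word<tail⇔ : ∀ {r k} → r ≤ i → suc i < k → k ≤ n → W r < W k ⇔ W (wordPos r) < W k
  word<tail⇔ {r} r≤i i+1<k k≤n with r <? j
  ... | yes r<j rewrite wordPos-< r<j = ⇔.refl
  ... | no r≮j =
        ⇔.trans (window<tail⇔ (≮⇒≥ r≮j) r≤i i+1<k k≤n)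
                (⇔.sym (window<tail⇔ (proj₁ window) (proj₂ window) i+1<k k≤n))
    where window = wordPos-window (≮⇒≥ r≮j) r≤i

  below-next⇔ : ∀ {r} → r ≤ i → NonInversion W r (suc i) ⇔ r < j
  below-next⇔ r≤i = mk⇔
    (λ (_ , Wr<next) → ≰⇒> λ j≤r →
       <-asym Wr<next (<-≤-trans next<W-j (W-increasing-≤ j≤r r≤i)))
    (λ r<j → s≤s r≤i , W<next r<j)

  word-below-j⇔ : ∀ {r} → r ≤ i → (r < i × W (wordPos r) < W (wordPos i)) ⇔ r < j
  word-below-j⇔ {r} r≤i rewrite wordPos-i = mk⇔
    (λ (r<i , lt) → ≰⇒> λ j≤r →
       <-asym lt (subst (λ p → W j < W p) (sym (wordPos-shift j≤r r<i))
                        (W-increasing (s≤s j≤r) r<i)))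
    (λ r<j → <-≤-trans r<j j≤i ,
       subst (λ p → W p < W j) (sym (wordPos-< r<j)) (W-increasing r<j j≤i))

  later-row : ∀ {r q} → i < r →
    NonInversion W (punchInℕ (suc i) r) (punchInℕ i q) ⇔ (r < q × W (wordPos r) < W (wordPos q))
  later-row {r} {q} i<r rewrite punchInℕ-≥ i<r | wordPos-> i<r with i <? q
  ... | yes i<q rewrite punchInℕ-≥ (<⇒≤ i<q) | wordPos-> i<q =
        mk⇔ (λ (r+1<q+1 , lt) → s<s⁻¹ r+1<q+1 , lt) (λ (r<q , lt) → s<s r<q , lt)
  ... | no i≮q = mk⇔ (λ (r+1<col , _) → contradiction col≤r+1 (<⇒≱ r+1<col))
                 (λ (r<q , _) → contradiction (<-trans i<r r<q) i≮q)
    where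
    col≤r+1 : punchInℕ i q ≤ suc r
    col≤r+1 = ≤-trans (punchInℕ-≤ i q) (s≤s (≤-trans (≮⇒≥ i≮q) (<⇒≤ i<r)))

  early-column : ∀ {r q} → r ≤ i → q < i →
    NonInversion W (punchInℕ (suc i) r) (punchInℕ i q) ⇔ (r < q × W (wordPos r) < W (wordPos q))
  early-column r≤i q<i rewrite punchInℕ-< (s≤s r≤i) | punchInℕ-< q<i =
    ⇔.trans (nonInversion⇔< (λ a<q → W-increasing a<q (<⇒≤ q<i)))
            (⇔.sym (nonInversion⇔< (λ a<q → word-increasing a<q q<i)))

  middle-column : ∀ {r} → r ≤ i →
    NonInversion W (punchInℕ (suc i) r) (punchInℕ i i) ⇔ (r < i × W (wordPos r) < W (wordPos i))
  middle-column r≤i rewrite punchInℕ-< (s≤s r≤i) | punchInℕ-≥ (≤-refl {i}) =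
    ⇔.trans (below-next⇔ r≤i) (⇔.sym (word-below-j⇔ r≤i))

  later-column : ∀ {r q} → r ≤ i → i < q → q < n →
    NonInversion W (punchInℕ (suc i) r) (punchInℕ i q) ⇔ (r < q × W (wordPos r) < W (wordPos q))
  later-column {r} {q} r≤i i<q q<n
    rewrite punchInℕ-< (s≤s r≤i) | punchInℕ-≥ (<⇒≤ i<q) | wordPos-> i<q =
    mk⇔ (λ (_ , lt) → r<q , Equivalence.to tail lt)
        (λ (_ , lt) → m<n⇒m<1+n r<q , Equivalence.from tail lt)
    where
    r<q = ≤-<-trans r≤i i<q
    tail = word<tail⇔ r≤i (s≤s i<q) q<n

  nonInversion-reduction : ∀ {r q} → q < n →
    NonInversion W (punchInℕ (suc i) r) (punchInℕ i q) ⇔ NonInversion (W ∘ wordPos) r q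
  nonInversion-reduction {r} {q} q<n with i <? r | <-cmp q i
  ... | yes i<r | _ = later-row i<r
  ... | no i≮r | tri< q<i _ _ = early-column (≮⇒≥ i≮r) q<i
  ... | no i≮r | tri≈ _ refl _ = middle-column (≮⇒≥ i≮r)
  ... | no i≮r | tri> _ _ i<q = later-column (≮⇒≥ i≮r) i<q q<n

O-image : ∀ {m} (u : Perm m) r b → O u r (u ⟨$⟩ʳ b) ⇔ (toℕ r < toℕ b × val u r < val u b)
O-image u r b = mk⇔
  (λ (b′ , r<b′ , ub′≡ub , lt) →
     subst (λ x → toℕ r < toℕ x × val u r < val u x)
           (Injection.injective (↔⇒↣ u) ub′≡ub) (r<b′ , lt))
  (λ (r<b , lt) → b , r<b , refl , lt)

nonInversion-extend : ∀ {n} (f : Fin n → ℕ) a b →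
  (toℕ a < toℕ b × f a < f b) ⇔ (toℕ a < toℕ b × extend f (toℕ a) < extend f (toℕ b))
nonInversion-extend f a b rewrite extend-toℕ f a | extend-toℕ f b = ⇔.refl

module HeavyReduction {n} (w : Perm (suc n)) (i : Fin n) (j : Fin (suc n))
  (descent : IsDescent w i)
  (no-earlier-descent : ∀ k → toℕ k < toℕ i → ¬ IsDescent w k)
  (j-above : val w (fsuc i) < val w j)
  (j-minimal : ∀ k → toℕ k < toℕ j → ¬ val w (fsuc i) < val w k)
  (m : ℕ)
  (early-gap : ∀ k → toℕ k < toℕ i → ¬ (val w (fsuc i) < val w k × val w k ≤ m))
  (late-gap : ∀ k → suc (toℕ i) < toℕ k → ¬ (m < val w k × val w k < val w (inject₁ i)))
  where

  W : ℕ → ℕ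
  W = extend (val w)

  W-at : ∀ a {k} → toℕ a ≡ k → W k ≡ val w a
  W-at a refl = extend-toℕ (val w) a

  W-injective : ∀ {a b} → a ≤ n → b ≤ n → W a ≡ W b → a ≡ b
  W-injective a≤n b≤n =
    extend-injective (Injection.injective (↔⇒↣ w) ∘ toℕ-injective) (s≤s a≤n) (s≤s b≤n)

  no-descent-before : ∀ {k} → k < toℕ i → W k ≤ W (suc k)
  no-descent-before {k} k<I = ≮⇒≥ λ lt →
    no-earlier-descent a (subst (_< toℕ i) (sym a≡k) k<I)
      (subst₂ _<_ (W-at (fsuc a) (cong suc a≡k))
                  (W-at (inject₁ a) (trans (toℕ-inject₁ a) a≡k)) lt)
    where
    k<n = <-trans k<I (toℕ<n i)
    a = fromℕ< k<n
    a≡k = toℕ-fromℕ< k<n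

  W-increasing : ∀ {a b} → a < b → b ≤ toℕ i → W a < W b
  W-increasing a<b b≤I = ≤∧≢⇒< (ascending-≤ no-descent-before (<⇒≤ a<b) b≤I)
    (λ Wa≡Wb → <⇒≢ a<b (W-injective (≤-trans (<⇒≤ a<b) b≤n) b≤n Wa≡Wb))
    where b≤n = ≤-trans b≤I (<⇒≤ (toℕ<n i))

  j≤i : toℕ j ≤ toℕ i
  j≤i = ≮⇒≥ λ I<J →
    j-minimal (inject₁ i) (subst (_< toℕ j) (sym (toℕ-inject₁ i)) I<J) descent

  next≡ : W (suc (toℕ i)) ≡ val w (fsuc i)
  next≡ = W-at (fsuc i) refl

  next<W-j : W (suc (toℕ i)) < W (toℕ j)
  next<W-j = subst₂ _<_ (sym next≡) (sym (W-at j refl)) j-above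

  W<next : ∀ {k} → k < toℕ j → W k < W (suc (toℕ i))
  W<next {k} k<J = ≤∧≢⇒< (≮⇒≥ (¬next<Wk ∘ subst (_< W k) next≡))
    (λ Wk≡next →
       <⇒≢ (<-≤-trans k<J (m≤n⇒m≤1+n j≤i)) (W-injective k≤n (toℕ<n i) Wk≡next))
    where
    k≤n = ≤-trans (<⇒≤ k<J) (≤-pred (toℕ<n j))
    ¬next<Wk : ¬ val w (fsuc i) < W k
    ¬next<Wk =
      extend-∀ {P = λ k y → k < toℕ j → ¬ val w (fsuc i) < y} j-minimal (s≤s k≤n) k<J

  tail<W-i⇒≤m : ∀ {k} → suc (toℕ i) < k → k ≤ n → W k < W (toℕ i) → W k ≤ m
  tail<W-i⇒≤m {k} I+1<k k≤n Wk<WI = ≮⇒≥ λ m<Wk →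
    extend-∀ {P = λ k y → suc (toℕ i) < k → ¬ (m < y × y < val w (inject₁ i))}
      late-gap (s≤s k≤n) I+1<k (m<Wk , subst (W k <_) (W-at (inject₁ i) (toℕ-inject₁ i)) Wk<WI)

  m<W-j : toℕ j < toℕ i → m < W (toℕ j)
  m<W-j J<I = subst (m <_) (sym (W-at j refl)) (≰⇒> λ Wj≤m → early-gap j J<I (j-above , Wj≤m))

  tail-outside : ∀ {k} → suc (toℕ i) < k → k ≤ n → W k < W (toℕ j) ⊎ W (toℕ i) < W k
  tail-outside {k} I+1<k k≤n with <-cmp (W k) (W (toℕ i))
  ... | tri> _ _ WI<Wk = inj₂ WI<Wk
  ... | tri≈ _ Wk≡WI _ =
        contradiction (W-injective k≤n (<⇒≤ (toℕ<n i)) Wk≡WI)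
                      (>⇒≢ (<-trans (n<1+n _) I+1<k))
  ... | tri< Wk<WI _ _ with m≤n⇒m<n∨m≡n j≤i
  ...   | inj₁ J<I = inj₁ (≤-<-trans (tail<W-i⇒≤m I+1<k k≤n Wk<WI) (m<W-j J<I))
  ...   | inj₂ J≡I = inj₁ (subst (λ x → W k < W x) (sym J≡I) Wk<WI)

  open Reduction n (toℕ i) (toℕ j) W W-increasing j≤i next<W-j W<next tail-outside public

  vWord≡ : ∀ p → vWord w i j p ≡ W (wordPos (toℕ p))
  vWord≡ p with toℕ p ≟ toℕ i
  ... | yes _ = sym (W-at j refl)
  ... | no _ with toℕ p <? toℕ j
  ...   | yes _ = sym (W-at (inject₁ p) (toℕ-inject₁ p))
  ...   | no _ = sym (W-at (fsuc p) refl)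

  Deleted : Diagram n
  Deleted = delete (O w) (fsuc i) (w ⟨$⟩ʳ inject₁ i)

  ρ : Permutation′ n
  ρ = remove (inject₁ i) w

  Deleted⇔ : ∀ r q →
             Deleted r (ρ ⟨$⟩ʳ q) ⇔ NonInversion (W ∘ wordPos) (toℕ r) (toℕ q)
  Deleted⇔ r q = begin
    O w R (punchIn (w ⟨$⟩ʳ inject₁ i) (ρ ⟨$⟩ʳ q))
      ≡⟨ cong (O w R) (sym (punchIn-permute w (inject₁ i) q)) ⟩
    O w R (w ⟨$⟩ʳ B)
      ∼⟨ O-image w R B ⟩
    (toℕ R < toℕ B × val w R < val w B)
      ∼⟨ nonInversion-extend (val w) R B ⟩
    NonInversion W (toℕ R) (toℕ B)
      ≡⟨ cong₂ (NonInversion W) (toℕ-punchIn (fsuc i) r) toℕ-B ⟩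
    NonInversion W (punchInℕ (suc (toℕ i)) (toℕ r)) (punchInℕ (toℕ i) (toℕ q))
      ∼⟨ nonInversion-reduction (toℕ<n q) ⟩
    NonInversion (W ∘ wordPos) (toℕ r) (toℕ q) ∎
    where
    open EquationalReasoning
    R = punchIn (fsuc i) r
    B = punchIn (inject₁ i) q
    toℕ-B : toℕ B ≡ punchInℕ (toℕ i) (toℕ q)
    toℕ-B = trans (toℕ-punchIn (inject₁ i) q)
                  (cong (λ x → punchInℕ x (toℕ q)) (toℕ-inject₁ i))

  module _ (v : Perm n) (v≅word : OrderIsomorphic v (vWord w i j)) where

    O-v⇔ : ∀ r q → O v r (v ⟨$⟩ʳ q) ⇔ NonInversion (W ∘ wordPos) (toℕ r) (toℕ q)
    O-v⇔ r q = begin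
      O v r (v ⟨$⟩ʳ q)
        ∼⟨ O-image v r q ⟩
      (toℕ r < toℕ q × val v r < val v q)
        ∼⟨ ⇔.refl ×-⇔ v≅word r q ⟩
      (toℕ r < toℕ q × vWord w i j r < vWord w i j q)
        ≡⟨ cong₂ (λ x y → toℕ r < toℕ q × x < y) (vWord≡ r) (vWord≡ q) ⟩
      NonInversion (W ∘ wordPos) (toℕ r) (toℕ q) ∎
      where open EquationalReasoning

    Deleted⇔O-v : ∀ r c → Deleted r c ⇔ O v r ((flip ρ ∘ₚ v) ⟨$⟩ʳ c)
    Deleted⇔O-v r c = subst (λ c′ → Deleted r c′ ⇔ O v r (v ⟨$⟩ʳ q)) (inverseʳ ρ)
      (⇔.trans (Deleted⇔ r q) (⇔.sym (O-v⇔ r q)))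
      where q = ρ ⟨$⟩ˡ c

proposition3p9 : (n : ℕ) (w : Perm (suc n)) (i : Fin n)
    → IsFirstDescent w i
    → IsHeavyReductionPair w i
    → (j : Fin (suc n)) → IsMinAbove w i j
    → (v : Perm n) → OrderIsomorphic v (vWord w i j)
    → EquivUpToRowsCols (delete (O w) (fsuc i) (w ⟨$⟩ʳ inject₁ i)) (O v)
proposition3p9 n w i (descent , no-earlier-descent) (_ , _ , _ , m , _ , _ , early-gap , late-gap)
               j (j-above , j-minimal) v v≅word =
  idₚ , flip ρ ∘ₚ v , Deleted⇔O-v v v≅word
  where
  open HeavyReduction w i j descent no-earlier-descent j-above j-minimal m early-gap late-gap
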